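{- Let $D_0$ be a northeast diagram and $D\in\mathcal{P}(D_0)$. Then there exists an elementary chain in $\mathcal{P}(D_0)$ with maximal element $D_0$ and minimal element $D$ that contains no move inversions.
   Context: A diagram is a finite subset of $\mathbb{N}\times\mathbb{N}$; $(r,c)$ is a cell in row $r$, column $c$, rows numbered bottom to top. A Kohnert move on $D$ takes the rightmost cell $(r,c)$ of some row and moves it to $(r',c)$, $r'$ the largest $1\le r'<r$ with $(r',c)\notin D$ (no move if none); it is elementary if $r'=r-1$. $\mathcal{P}(D_0)$ is the set of diagrams obtainable from $D_0$ by finitely many Kohnert moves, ordered by the transitive closure of $D_2<D_1$ when $D_2$ results from $D_1$ by one Kohnert move. $D$ is northeast if for all cells $(r_1,c_1),(r_2,c_2)\in D$, $(\max(r_1,r_2),\max(c_1,c_2))\in D$. For $E\in\mathcal{P}(D_0)$, the standard labeling of $E$ with respect to $D_0$ is the unique labeling of $E$ by positive integers that strictly increases from bottom to top in each column and whose set of labels in each column $c$ equals the set of row indices of cells of $D_0$ in column $c$. An elementary chain in $\mathcal{P}(D_0)$ is a saturated chain $D_1\gtrdot D_2\gtrdot\cdots\gtrdot D_M$ such that each $D_{a+1}$ is obtained from $D_a$ by a single elementary Kohnert move; its maximal element is $D_1$ and minimal element $D_M$. For such a step, $\mathrm{movelabel}(D_a,D_{a+1})=i$ if the moved cell has label $i$ in the standard labeling of $D_a$ with respect to $D_0$. A move inversion is a pair $(a,b)$ with $1\le a<b\le M-1$ and $\mathrm{movelabel}(D_a,D_{a+1})>\mathrm{movelabel}(D_b,D_{b+1})$.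 -}

module Defs where

open import Data.Nat using (ℕ; zero; suc; _<_; _≤_; _⊔_)
open import Data.Product using (Σ; ∃; _×_; _,_)
open import Data.Sum using (_⊎_)
open import Data.List using (List)
open import Data.List.Membership.Propositional using (_∈_; _∉_)
open import Relation.Binary.PropositionalEquality using (_≡_; _≢_)
open import Relation.Nullary using (¬_)
open import Function.Bundles using (_⇔_)
open import Relation.Binary.Construct.Closure.ReflexiveTransitive using (Star)
open import Relation.Binary.Construct.Closure.Transitive using (Plus)

-- A cell is (row , column); rows numbered bottom to top.
Cell : Set
Cell = ℕ × ℕ

-- A diagram is a finite subset of ℕ × ℕ, represented by a list of its
-- cells; only membership matters (order / duplicates are irrelevant).
Diagram : Set
Diagram = List Cell

_≐_ : Diagram → Diagram → Set
D ≐ E = ∀ x → (x ∈ D) ⇔ (x ∈ E)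

PositiveDiagram : Diagram → Set
PositiveDiagram D = ∀ r c → (r , c) ∈ D → (1 ≤ r) × (1 ≤ c)

Northeast : Diagram → Set
Northeast D = ∀ r₁ c₁ r₂ c₂ → (r₁ , c₁) ∈ D → (r₂ , c₂) ∈ D →
  (r₁ ⊔ r₂ , c₁ ⊔ c₂) ∈ D

KMove : Diagram → ℕ → ℕ → ℕ → Diagram → Set
KMove D r c r' E =
  ((r , c) ∈ D) ×
  (∀ c' → c < c' → (r , c') ∉ D) ×
  (1 ≤ r') × (r' < r) × ((r' , c) ∉ D) ×
  (∀ r'' → r' < r'' → r'' < r → (r'' , c) ∈ D) ×
  (∀ x → (x ∈ E) ⇔ (((x ∈ D) × (x ≢ (r , c))) ⊎ (x ≡ (r' , c))))

KohnertStep : Diagram → Diagram → Set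
KohnertStep D E = ∃ λ r → ∃ λ c → ∃ λ r' → KMove D r c r' E

ElemMove : Diagram → Cell → Diagram → Set
ElemMove D (r , c) E = Σ ℕ λ r' → (suc r' ≡ r) × KMove D r c r' E

InP : Diagram → Diagram → Set
InP D₀ E = Σ Diagram λ E' → Star KohnertStep D₀ E' × (E' ≐ E)

_≺_ : Diagram → Diagram → Set
E ≺ D = Plus KohnertStep D E

CoveredBy : Diagram → Diagram → Diagram → Set
CoveredBy D₀ E D = (E ≺ D) × ¬ (Σ Diagram λ F → InP D₀ F × (E ≺ F) × (F ≺ D))

-- L is the standard labeling of E with respect to D₀ (values of L off E
-- are irrelevant).
StandardLabeling : Diagram → Diagram → (Cell → ℕ) → Set
StandardLabeling D₀ E L =
  (∀ x → x ∈ E → 1 ≤ L x) ×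
  (∀ r₁ r₂ c → (r₁ , c) ∈ E → (r₂ , c) ∈ E → r₁ < r₂ → L (r₁ , c) < L (r₂ , c)) ×
  (∀ c ℓ → (∃ λ r → ((r , c) ∈ E) × (L (r , c) ≡ ℓ)) ⇔ ((ℓ , c) ∈ D₀))

-- An elementary chain D_0 ⋗ D_1 ⋗ ... ⋗ D_M in 𝒫(D₀) (indices shifted to
-- start at 0), given by the diagrams Ds i (i ≤ M), the moved cells
-- cells a (a < M) and their move labels labs a (a < M).
record ElementaryChain (D₀ : Diagram) : Set where
  field
    M      : ℕ
    Ds     : ℕ → Diagram
    cells  : ℕ → Cell
    labs   : ℕ → ℕ
    inP    : ∀ a → a ≤ M → InP D₀ (Ds a)
    elem   : ∀ a → a < M → ElemMove (Ds a) (cells a) (Ds (suc a))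
    cover  : ∀ a → a < M → CoveredBy D₀ (Ds (suc a)) (Ds a)
    label  : ∀ a → a < M →
      Σ (Cell → ℕ) λ L → StandardLabeling D₀ (Ds a) L × (L (cells a) ≡ labs a)

open ElementaryChain public

NoMoveInversions : ∀ {D₀} → ElementaryChain D₀ → Set
NoMoveInversions ch = ∀ a b → a < b → b < M ch → ¬ (labs ch b < labs ch a)

{-# OPTIONS --safe #-}
-- A diagram of 𝒫(D₀) is recorded by a placement t: the row t p to which each cell p of D₀ has
-- moved.  Columns never change and every column keeps its bottom-to-top order, so the cell at
-- (t p , col p) has standard label row p.  For northeast D₀ every reachable placement moreover
-- satisfies t (j , c′) ≤ t (i , c) whenever c < c′ and j ≤ i.  Given the placement T of the
-- target, settle the cells of D₀ by increasing row and, within a row, from right to left,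
-- moving each one straight down from its original row to its row in T one step at a time.
-- The invariant of T makes each step a legal elementary move (the moving cell is rightmost in
-- its row and the cell below it is empty); a move lowering a single cell by one row is a cover
-- in 𝒫(D₀); and the move labels, being original rows, never decrease.
module Submission where

open import Defs
open import Data.Nat using (ℕ; zero; suc; pred; _+_; _∸_; z<s; _<_; _≤_; _≟_; _<?_; _≤?_; z≤n; s≤s; >-nonZero)
open import Data.Nat.Properties
open import Data.Product using (Σ; ∃; _×_; _,_; proj₁; proj₂)
open import Data.Product.Properties using (≡-dec)
open import Data.Sum using (_⊎_; inj₁; inj₂; [_,_]′)
import Data.Sum as Sum
import Data.Product as Product
open import Data.List using (map)
open import Data.List.Properties using (map-cong-local)
import Data.List.Relation.Unary.All as All
open import Data.List.Relation.Unary.Any using (any?)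
open import Data.List.Membership.Propositional using (_∈_; _∉_; find; lose)
open import Data.List.Membership.Propositional.Properties using (∈-map⁺; ∈-map⁻)
open import Data.List.Extrema.Nat using (max; xs≤max)
open import Data.Empty using (⊥; ⊥-elim)
open import Function using (id)
open import Function.Bundles using (_⇔_; mk⇔; Equivalence)
open import Relation.Nullary using (¬_; Dec; yes; no)
open import Relation.Nullary.Decidable using (_×-dec_; _⊎-dec_)
open import Relation.Binary.Definitions using (tri<; tri≈; tri>)
open import Relation.Binary.PropositionalEquality using (_≡_; _≢_; refl; sym; trans; cong; cong₂; subst; subst₂)
open import Relation.Binary.Construct.Closure.ReflexiveTransitive using (Star; ε; _◅_; _◅◅_)
open import Relation.Binary.Construct.Closure.Transitive using (Plus; [_]; _∼⁺⟨_⟩_)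
open import Data.Nat.Induction using (<-rec)

m<n⇒pred[n]<n : ∀ {m n} → m < n → pred n < n
m<n⇒pred[n]<n (s≤s _) = ≤-refl

≤-max : ∀ {A : Set} (f : A → ℕ) {x xs} → x ∈ xs → f x ≤ max 0 (map f xs)
≤-max f {xs = xs} m = All.lookup (xs≤max 0 (map f xs)) (∈-map⁺ f m)

≐-refl : ∀ {D} → D ≐ D
≐-refl _ = mk⇔ id id

≐-reflexive : ∀ {D E} → D ≡ E → D ≐ E
≐-reflexive refl = ≐-refl

≐-sym : ∀ {D E} → D ≐ E → E ≐ D
≐-sym D≐E x = mk⇔ (Equivalence.from (D≐E x)) (Equivalence.to (D≐E x))

≐-trans : ∀ {D E F} → D ≐ E → E ≐ F → D ≐ F
≐-trans D≐E E≐F x = mk⇔ (λ m → Equivalence.to (E≐F x) (Equivalence.to (D≐E x) m))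
                        (λ m → Equivalence.from (D≐E x) (Equivalence.from (E≐F x) m))

row col : Cell → ℕ
row = proj₁
col = proj₂

_≟ᶜ_ : (p q : Cell) → Dec (p ≡ q)
_≟ᶜ_ = ≡-dec _≟_ _≟_

KMove-respˡ : ∀ {D D′ E r c r′} → D ≐ D′ → KMove D′ r c r′ E → KMove D r c r′ E
KMove-respˡ {D} {D′} D≐ (moved , rightmost , r′≥1 , r′<r , hole , between , E≐) =
  from moved , (λ c′ lt m → rightmost c′ lt (to m)) , r′≥1 , r′<r , (λ m → hole (to m)) ,
  (λ u lo hi → from (between u lo hi)) ,
  λ x → mk⇔ (λ m → Sum.map₁ (Product.map₁ from) (Equivalence.to (E≐ x) m))
            (λ m → Equivalence.from (E≐ x) (Sum.map₁ (Product.map₁ to) m))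
  where
  to : ∀ {x} → x ∈ D → x ∈ D′
  to {x} = Equivalence.to (D≐ x)
  from : ∀ {x} → x ∈ D′ → x ∈ D
  from {x} = Equivalence.from (D≐ x)

InP-step : ∀ {D₀ D E} → InP D₀ D → KohnertStep D E → InP D₀ E
InP-step (_ , moves , D′≐D) (_ , _ , _ , km) =
  _ , moves ◅◅ ((_ , _ , _ , KMove-respˡ D′≐D km) ◅ ε) , ≐-refl

-- The order in which the cells are settled.
_⊏_ : Cell → Cell → Set
(j , c′) ⊏ (i , c) = j < i ⊎ (j ≡ i × c < c′)

_⊏?_ : (p q : Cell) → Dec (p ⊏ q)
(j , c′) ⊏? (i , c) = (j <? i) ⊎-dec ((j ≟ i) ×-dec (c <? c′))

⊏-irrefl : ∀ {p} → ¬ p ⊏ p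
⊏-irrefl (inj₁ j<j) = <-irrefl refl j<j
⊏-irrefl (inj₂ (_ , c<c)) = <-irrefl refl c<c

⊏-leftward : ∀ {i c} p → p ⊏ (i , c) ⇔ (p ⊏ (i , suc c) ⊎ p ≡ (i , suc c))
⊏-leftward {i} {c} (j , c′) = mk⇔ to from
  where
  to : (j , c′) ⊏ (i , c) → ((j , c′) ⊏ (i , suc c)) ⊎ ((j , c′) ≡ (i , suc c))
  to (inj₁ j<i) = inj₁ (inj₁ j<i)
  to (inj₂ (refl , c<c′)) with m≤n⇒m<n∨m≡n c<c′
  ... | inj₁ 1+c<c′ = inj₁ (inj₂ (refl , 1+c<c′))
  ... | inj₂ refl = inj₂ refl
  from : ((j , c′) ⊏ (i , suc c)) ⊎ ((j , c′) ≡ (i , suc c)) → (j , c′) ⊏ (i , c)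
  from (inj₁ (inj₁ j<i)) = inj₁ j<i
  from (inj₁ (inj₂ (refl , 1+c<c′))) = inj₂ (refl , <-trans (n<1+n c) 1+c<c′)
  from (inj₂ refl) = inj₂ (refl , n<1+n c)

⊏-upward : ∀ {i B} p → col p ≤ B → p ⊏ (suc i , B) ⇔ (p ⊏ (i , 0) ⊎ p ≡ (i , 0))
⊏-upward {i} {B} (j , c′) c′≤B = mk⇔ to from
  where
  left-of-start : ∀ c → ((i , c) ⊏ (i , 0)) ⊎ ((i , c) ≡ (i , 0))
  left-of-start zero = inj₂ refl
  left-of-start (suc c) = inj₁ (inj₂ (refl , z<s))
  to : (j , c′) ⊏ (suc i , B) → ((j , c′) ⊏ (i , 0)) ⊎ ((j , c′) ≡ (i , 0))
  to (inj₁ j<1+i) with m≤n⇒m<n∨m≡n (≤-pred j<1+i)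
  ... | inj₁ j<i = inj₁ (inj₁ j<i)
  ... | inj₂ refl = left-of-start c′
  to (inj₂ (_ , B<c′)) = ⊥-elim (<⇒≱ B<c′ c′≤B)
  from : ((j , c′) ⊏ (i , 0)) ⊎ ((j , c′) ≡ (i , 0)) → (j , c′) ⊏ (suc i , B)
  from (inj₁ (inj₁ j<i)) = inj₁ (m<n⇒m<1+n j<i)
  from (inj₁ (inj₂ (refl , _))) = inj₁ (n<1+n j)
  from (inj₂ refl) = inj₁ (n<1+n i)

Placement : Set
Placement = Cell → ℕ

module Placements (D₀ : Diagram) where

  diagramOf : Placement → Diagram
  diagramOf t = map (λ p → (t p , col p)) D₀

  ∈-diagramOf⁺ : ∀ t {i c u} → (i , c) ∈ D₀ → t (i , c) ≡ u → (u , c) ∈ diagramOf t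
  ∈-diagramOf⁺ t m refl = ∈-map⁺ _ m

  ∈-diagramOf⁻ : ∀ t {u c} → (u , c) ∈ diagramOf t → ∃ λ i → (i , c) ∈ D₀ × t (i , c) ≡ u
  ∈-diagramOf⁻ t m with ∈-map⁻ _ m
  ... | (i , _) , m′ , refl = i , m′ , refl

  diagramOf-row : D₀ ≐ diagramOf row
  diagramOf-row (u , c) = mk⇔ (λ m → ∈-diagramOf⁺ row m refl) from
    where
    from : (u , c) ∈ diagramOf row → (u , c) ∈ D₀
    from m with ∈-diagramOf⁻ row m
    ... | _ , m′ , refl = m′

  _≈_ : Placement → Placement → Set
  t ≈ t′ = ∀ {p} → p ∈ D₀ → t p ≡ t′ p

  ≈-trans : ∀ {t₁ t₂ t₃} → t₁ ≈ t₂ → t₂ ≈ t₃ → t₁ ≈ t₃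
  ≈-trans e e′ m = trans (e m) (e′ m)

  diagramOf-cong : ∀ {t t′} → t ≈ t′ → diagramOf t ≡ diagramOf t′
  diagramOf-cong e = map-cong-local (All.tabulate λ m → cong (_, _) (e m))

  ColumnStrict : Placement → Set
  ColumnStrict t = ∀ {i j c} → (i , c) ∈ D₀ → (j , c) ∈ D₀ → i < j → t (i , c) < t (j , c)

  Positive : Placement → Set
  Positive t = ∀ {p} → p ∈ D₀ → 1 ≤ t p

  Descended : Placement → Set
  Descended t = ∀ {p} → p ∈ D₀ → t p ≤ row p

  RightDominated : Placement → Set
  RightDominated t = ∀ {i j c c′} → (i , c) ∈ D₀ → (j , c′) ∈ D₀ → c < c′ → j ≤ i →
    t (j , c′) ≤ t (i , c)

  module _ {t : Placement} (strict : ColumnStrict t) {i j c : ℕ}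
           (mi : (i , c) ∈ D₀) (mj : (j , c) ∈ D₀) where

    strict-injective : t (i , c) ≡ t (j , c) → i ≡ j
    strict-injective e with <-cmp i j
    ... | tri< i<j _ _ = ⊥-elim (<-irrefl e (strict mi mj i<j))
    ... | tri≈ _ i≡j _ = i≡j
    ... | tri> _ _ j<i = ⊥-elim (<-irrefl (sym e) (strict mj mi j<i))

    strict-cancel-< : t (i , c) < t (j , c) → i < j
    strict-cancel-< lt with <-cmp i j
    ... | tri< i<j _ _ = i<j
    ... | tri≈ _ refl _ = ⊥-elim (<-irrefl refl lt)
    ... | tri> _ _ j<i = ⊥-elim (<-asym lt (strict mj mi j<i))

    strict-mono-≤ : i ≤ j → t (i , c) ≤ t (j , c)
    strict-mono-≤ i≤j with m≤n⇒m<n∨m≡n i≤j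
    ... | inj₁ i<j = <⇒≤ (strict mi mj i<j)
    ... | inj₂ refl = ≤-refl

  labelAt : Placement → Cell → ℕ
  labelAt t (u , c) with any? (λ p → (t p ≟ u) ×-dec (col p ≟ c)) D₀
  ... | yes found = row (proj₁ (find found))
  ... | no _ = 0

  labelAt-correct : ∀ {t} → ColumnStrict t → ∀ {i c} → (i , c) ∈ D₀ → labelAt t (t (i , c) , c) ≡ i
  labelAt-correct {t} strict {i} {c} m with any? (λ p → (t p ≟ t (i , c)) ×-dec (col p ≟ c)) D₀
  ... | no none = ⊥-elim (none (lose m (refl , refl)))
  ... | yes found with find found
  ...   | (j , _) , m′ , e , refl = strict-injective strict m′ m e

  standardLabeling : PositiveDiagram D₀ → ∀ {t} → ColumnStrict t →
    StandardLabeling D₀ (diagramOf t) (labelAt t)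
  standardLabeling pos {t} strict = positive , increasing , labels
    where
    positive : ∀ x → x ∈ diagramOf t → 1 ≤ labelAt t x
    positive (u , c) m with ∈-diagramOf⁻ t m
    ... | i , mi , refl rewrite labelAt-correct strict mi = proj₁ (pos i c mi)

    increasing : ∀ r₁ r₂ c → (r₁ , c) ∈ diagramOf t → (r₂ , c) ∈ diagramOf t → r₁ < r₂ →
      labelAt t (r₁ , c) < labelAt t (r₂ , c)
    increasing _ _ c m₁ m₂ lt with ∈-diagramOf⁻ t m₁ | ∈-diagramOf⁻ t m₂
    ... | i₁ , mi₁ , refl | i₂ , mi₂ , refl
      rewrite labelAt-correct strict mi₁ | labelAt-correct strict mi₂ = strict-cancel-< strict mi₁ mi₂ lt

    labels : ∀ c ℓ → (∃ λ r → ((r , c) ∈ diagramOf t) × (labelAt t (r , c) ≡ ℓ)) ⇔ ((ℓ , c) ∈ D₀)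
    labels c ℓ = mk⇔ to (λ m → t (ℓ , c) , ∈-diagramOf⁺ t m refl , labelAt-correct strict m)
      where
      to : (∃ λ r → ((r , c) ∈ diagramOf t) × (labelAt t (r , c) ≡ ℓ)) → (ℓ , c) ∈ D₀
      to (_ , m , refl) with ∈-diagramOf⁻ t m
      ... | i , mi , refl rewrite labelAt-correct strict mi = mi

  northeast-corner : Northeast D₀ → ∀ {i j c c′} → (i , c) ∈ D₀ → (j , c′) ∈ D₀ → j ≤ i → c ≤ c′ →
    (i , c′) ∈ D₀
  northeast-corner ne mi mj j≤i c≤c′ =
    subst (_∈ D₀) (cong₂ _,_ (m≥n⇒m⊔n≡m j≤i) (m≤n⇒m⊔n≡n c≤c′)) (ne _ _ _ _ mi mj)

  -- A Kohnert move of (r , c) to the hole (r′ , c) below the occupied cells r′+1, …, r−1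
  -- keeps the standard labels increasing in column c only if every cell of the segment
  -- r′+1, …, r moves down by one; this is what lower does to a placement.
  InSegment : ℕ → ℕ → ℕ → Cell → Set
  InSegment c r′ r (u , c₁) = c₁ ≡ c × r′ < u × u ≤ r

  inSegment? : ∀ c r′ r x → Dec (InSegment c r′ r x)
  inSegment? c r′ r (u , c₁) = (c₁ ≟ c) ×-dec (r′ <? u) ×-dec (u ≤? r)

  lower : Placement → ℕ → ℕ → ℕ → Placement
  lower t c r′ r p with inSegment? c r′ r (t p , col p)
  ... | yes _ = pred (t p)
  ... | no _ = t p

  module KohnertMove {t : Placement} (strict : ColumnStrict t) {D E : Diagram} (D≐ : D ≐ diagramOf t)
    {r c r′ : ℕ} (moved : (r , c) ∈ D) (rightmost : ∀ c′ → c < c′ → (r , c′) ∉ D)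
    (r′≥1 : 1 ≤ r′) (r′<r : r′ < r) (hole : (r′ , c) ∉ D)
    (between : ∀ u → r′ < u → u < r → (u , c) ∈ D)
    (E≐ : ∀ x → (x ∈ E) ⇔ (((x ∈ D) × (x ≢ (r , c))) ⊎ (x ≡ (r′ , c)))) where

    toD : ∀ {x} → x ∈ diagramOf t → x ∈ D
    toD {x} = Equivalence.from (D≐ x)

    occupant : ∀ {u} → r′ < u → u ≤ r → ∃ λ i → (i , c) ∈ D₀ × t (i , c) ≡ u
    occupant {u} lo hi = ∈-diagramOf⁻ t (Equivalence.to (D≐ _) occupied)
      where
      occupied : (u , c) ∈ D
      occupied with u ≟ r
      ... | yes refl = moved
      ... | no u≢r = between u lo (≤∧≢⇒< hi u≢r)

    t′ : Placement
    t′ = lower t c r′ r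

    t′-in : ∀ {p} → InSegment c r′ r (t p , col p) → t′ p ≡ pred (t p)
    t′-in {p} seg with inSegment? c r′ r (t p , col p)
    ... | yes _ = refl
    ... | no out = ⊥-elim (out seg)

    t′-out : ∀ {p} → ¬ InSegment c r′ r (t p , col p) → t′ p ≡ t p
    t′-out {p} out with inSegment? c r′ r (t p , col p)
    ... | yes seg = ⊥-elim (out seg)
    ... | no _ = refl

    t′≤t : ∀ p → t′ p ≤ t p
    t′≤t p with inSegment? c r′ r (t p , col p)
    ... | yes _ = pred[n]≤n
    ... | no _ = ≤-refl

    t′<t-somewhere : ∃ λ p → p ∈ D₀ × t′ p < t p
    t′<t-somewhere with occupant r′<r ≤-refl
    ... | i , mi , refl =
      (i , c) , mi , subst (_< r) (sym (t′-in (refl , r′<r , ≤-refl))) (m<n⇒pred[n]<n r′<r)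

    t′-positive : Positive t → Positive t′
    t′-positive pos {p} m with inSegment? c r′ r (t p , col p)
    ... | yes (_ , lo , _) = ≤-trans r′≥1 (<⇒≤pred lo)
    ... | no _ = pos m

    below-segment : ∀ {i} → (i , c) ∈ D₀ → ¬ InSegment c r′ r (t (i , c) , c) →
      t (i , c) < r → t (i , c) < r′
    below-segment {i} mi out a<r with <-cmp (t (i , c)) r′
    ... | tri< a<r′ _ _ = a<r′
    ... | tri≈ _ a≡r′ _ = ⊥-elim (hole (toD (∈-diagramOf⁺ t mi a≡r′)))
    ... | tri> _ _ r′<a = ⊥-elim (out (refl , r′<a , <⇒≤ a<r))

    t′-strict : ColumnStrict t′
    t′-strict {i} {j} {c₁} mi mj i<j
      with inSegment? c r′ r (t (i , c₁) , c₁) | inSegment? c r′ r (t (j , c₁) , c₁)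
    ... | yes (_ , lo , _) | yes _ = pred-mono-< {{>-nonZero (≤-<-trans z≤n lo)}} (strict mi mj i<j)
    ... | yes _ | no _ = ≤-<-trans pred[n]≤n (strict mi mj i<j)
    ... | no out | yes (refl , lo , hi) =
      <-≤-trans (below-segment mi out (<-≤-trans (strict mi mj i<j) hi)) (<⇒≤pred lo)
    ... | no _ | no _ = strict mi mj i<j

    lowered-occupant : ∀ {u} → r′ ≤ u → u < r → (u , c) ∈ diagramOf t′
    lowered-occupant {u} r′≤u u<r with occupant {suc u} (s≤s r′≤u) u<r
    ... | i , mi , e = ∈-diagramOf⁺ t′ mi (trans (t′-in seg) (cong pred e))
      where
      seg : InSegment c r′ r (t (i , c) , c)
      seg = refl , subst (r′ <_) (sym e) (s≤s r′≤u) , subst (_≤ r) (sym e) u<r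

    diagramOf-t′ : diagramOf t′ ≐ E
    diagramOf-t′ x =
      mk⇔ (λ m → Equivalence.from (E≐ x) (before m)) (λ m → after (Equivalence.to (E≐ x) m))
      where
      before : ∀ {x} → x ∈ diagramOf t′ → ((x ∈ D) × (x ≢ (r , c))) ⊎ (x ≡ (r′ , c))
      before {u , c₂} m with ∈-diagramOf⁻ t′ m
      ... | i , mi , e with inSegment? c r′ r (t (i , c₂) , c₂)
      ...   | no out =
        inj₁ (toD (∈-diagramOf⁺ t mi e) , λ eq → out (moved-cell (trans e (cong row eq)) (cong col eq)))
        where
        moved-cell : t (i , c₂) ≡ r → c₂ ≡ c → InSegment c r′ r (t (i , c₂) , c₂)
        moved-cell at-r c₂≡c = c₂≡c , subst (r′ <_) (sym at-r) r′<r , ≤-reflexive at-r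
      ...   | yes (refl , lo , hi) with u ≟ r′
      ...     | yes refl = inj₂ refl
      ...     | no u≢r′ = inj₁ (between u r′<u u<r , λ eq → <-irrefl (cong row eq) u<r)
        where
        r′<u : r′ < u
        r′<u = ≤∧≢⇒< (subst (r′ ≤_) e (<⇒≤pred lo)) (λ r′≡u → u≢r′ (sym r′≡u))
        u<r : u < r
        u<r = <-≤-trans (subst (_< t (i , c)) e (m<n⇒pred[n]<n lo)) hi
      after : ∀ {x} → ((x ∈ D) × (x ≢ (r , c))) ⊎ (x ≡ (r′ , c)) → x ∈ diagramOf t′
      after (inj₂ refl) = lowered-occupant ≤-refl r′<r
      after {u , c₂} (inj₁ (xD , x≢)) with inSegment? c r′ r (u , c₂)
      ... | yes (refl , lo , hi) = lowered-occupant (<⇒≤ lo) (≤∧≢⇒< hi (λ u≡r → x≢ (cong (_, c) u≡r)))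
      ... | no out with ∈-diagramOf⁻ t (Equivalence.to (D≐ _) xD)
      ...   | i , mi , refl = ∈-diagramOf⁺ t′ mi (t′-out out)

    module _ (ne : Northeast D₀) (dominated : RightDominated t) where

      -- The right twin would climb along the segment up to row r, to the right of the moved cell.
      no-twin-in-segment : ∀ n {m c₂} → c < c₂ → (m , c) ∈ D₀ → (m , c₂) ∈ D₀ →
        t (m , c) ≡ t (m , c₂) → r′ < t (m , c) → t (m , c) + n ≡ r → ⊥
      no-twin-in-segment zero c<c₂ mc mc₂ same lo top =
        rightmost _ c<c₂ (toD (∈-diagramOf⁺ t mc₂ (trans (sym same) (trans (sym (+-identityʳ _)) top))))
      no-twin-in-segment (suc n) {m} {c₂} c<c₂ mc mc₂ same lo top
        with occupant {suc (t (m , c))} (m<n⇒m<1+n lo) (subst (t (m , c) <_) top (m<m+n _ z<s))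
      ... | m′ , mc′ , e =
        no-twin-in-segment n c<c₂ mc′ mc₂′ same′ (subst (r′ <_) (sym e) (m<n⇒m<1+n lo))
                           (trans (cong (_+ n) e) (trans (sym (+-suc _ n)) top))
        where
        m<m′ : m < m′
        m<m′ = strict-cancel-< strict mc mc′ (subst (t (m , c) <_) (sym e) ≤-refl)
        mc₂′ : (m′ , c₂) ∈ D₀
        mc₂′ = northeast-corner ne mc′ mc₂ (<⇒≤ m<m′) (<⇒≤ c<c₂)
        same′ : t (m′ , c) ≡ t (m′ , c₂)
        same′ = ≤-antisym
          (subst (_≤ t (m′ , c₂)) (sym e) (subst (_< t (m′ , c₂)) (sym same) (strict mc₂ mc₂′ m<m′)))
          (dominated mc′ mc₂′ c<c₂ ≤-refl)

      t′-dominated : RightDominated t′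
      t′-dominated {i} {j} {c₁} {c₂} mi mj c₁<c₂ j≤i with inSegment? c r′ r (t (i , c₁) , c₁)
      ... | no _ = ≤-trans (t′≤t _) (dominated mi mj c₁<c₂ j≤i)
      ... | yes (refl , lo , hi) =
        subst (_≤ pred (t (i , c))) (sym (t′-out λ seg → <-irrefl (sym (proj₁ seg)) c₁<c₂))
              (<⇒≤pred (≤∧≢⇒< (dominated mi mj c₁<c₂ j≤i) no-twin))
        where
        no-twin : t (j , c₂) ≢ t (i , c)
        no-twin e = no-twin-in-segment (r ∸ t (i , c)) c₁<c₂ mi mi₂ same lo (m+[n∸m]≡n hi)
          where
          mi₂ : (i , c₂) ∈ D₀
          mi₂ = northeast-corner ne mi mj j≤i (<⇒≤ c₁<c₂)
          same : t (i , c) ≡ t (i , c₂)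
          same = ≤-antisym (subst (_≤ t (i , c₂)) e (strict-mono-≤ strict mj mi₂ j≤i))
                           (dominated mi mi₂ c₁<c₂ ≤-refl)

  record Invariant (t : Placement) : Set where
    field
      strict    : ColumnStrict t
      positive  : Positive t
      descended : Descended t
      dominated : RightDominated t

  invariant-row : PositiveDiagram D₀ → Invariant row
  invariant-row pos = record
    { strict = λ _ _ i<j → i<j
    ; positive = λ {p} m → proj₁ (pos (row p) (col p) m)
    ; descended = λ _ → ≤-refl
    ; dominated = λ _ _ _ j≤i → j≤i
    }

  reachable-placement : Northeast D₀ → ∀ {D E t} → Star KohnertStep D E → Invariant t →
    D ≐ diagramOf t → ∃ λ t′ → Invariant t′ × E ≐ diagramOf t′
  reachable-placement ne ε inv D≐ = _ , inv , D≐
  reachable-placement ne ((_ , _ , _ , moved , rightmost , r′≥1 , r′<r , hole , between , E≐) ◅ moves)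
                      inv D≐ =
    reachable-placement ne moves inv′ (≐-sym diagramOf-t′)
    where
    open Invariant inv
    open KohnertMove strict D≐ moved rightmost r′≥1 r′<r hole between E≐
    inv′ : Invariant t′
    inv′ = record
      { strict = t′-strict
      ; positive = t′-positive positive
      ; descended = λ m → ≤-trans (t′≤t _) (descended m)
      ; dominated = t′-dominated ne dominated
      }

  _≤ᴾ_ _<ᴾ_ : Placement → Placement → Set
  t ≤ᴾ t′ = ∀ {p} → p ∈ D₀ → t p ≤ t′ p
  t <ᴾ t′ = t ≤ᴾ t′ × ∃ λ p → p ∈ D₀ × t p < t′ p

  <ᴾ-trans : ∀ {t₁ t₂ t₃} → t₁ <ᴾ t₂ → t₂ <ᴾ t₃ → t₁ <ᴾ t₃
  <ᴾ-trans (t₁≤t₂ , _) (t₂≤t₃ , p , m , lt) =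
    (λ m′ → ≤-trans (t₁≤t₂ m′) (t₂≤t₃ m′)) , p , m , ≤-<-trans (t₁≤t₂ m) lt

  <ᴾ-respˡ-≈ : ∀ {t₁ t₂ t₃} → t₁ ≈ t₂ → t₁ <ᴾ t₃ → t₂ <ᴾ t₃
  <ᴾ-respˡ-≈ e (t₁≤t₃ , p , m , lt) =
    (λ m′ → subst (_≤ _) (e m′) (t₁≤t₃ m′)) , p , m , subst (_< _) (e m) lt

  descent-placement : ∀ {D E t} → ColumnStrict t → D ≐ diagramOf t → Plus KohnertStep D E →
    ∃ λ t′ → ColumnStrict t′ × E ≐ diagramOf t′ × t′ <ᴾ t
  descent-placement strict D≐ [ _ , _ , _ , moved , rightmost , r′≥1 , r′<r , hole , between , E≐ ] =
    t′ , t′-strict , ≐-sym diagramOf-t′ , (λ _ → t′≤t _) , t′<t-somewhere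
    where open KohnertMove strict D≐ moved rightmost r′≥1 r′<r hole between E≐
  descent-placement strict D≐ (_ ∼⁺⟨ first ⟩ rest) with descent-placement strict D≐ first
  ... | u , strict-u , F≐ , u<t with descent-placement strict-u F≐ rest
  ...   | w , strict-w , E≐ , w<u = w , strict-w , E≐ , <ᴾ-trans w<u u<t

  diagramOf-injective : ∀ {t₁ t₂} → ColumnStrict t₁ → ColumnStrict t₂ →
    diagramOf t₁ ≐ diagramOf t₂ → t₁ ≈ t₂
  diagramOf-injective {t₁} {t₂} s₁ s₂ same {i , c} = <-rec Agree agree i c
    where
    Agree : ℕ → Set
    Agree i = ∀ c → (i , c) ∈ D₀ → t₁ (i , c) ≡ t₂ (i , c)
    agree : ∀ i → (∀ {k} → k < i → Agree k) → Agree i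
    agree i ih c mi with ∈-diagramOf⁻ t₂ (Equivalence.to (same _) (∈-diagramOf⁺ t₁ mi refl))
                       | ∈-diagramOf⁻ t₁ (Equivalence.from (same _) (∈-diagramOf⁺ t₂ mi refl))
    ... | j , mj , t₂j≡t₁i | k , mk , t₁k≡t₂i with <-cmp j i | <-cmp k i
    ... | tri≈ _ refl _ | _ = sym t₂j≡t₁i
    ... | _ | tri≈ _ refl _ = t₁k≡t₂i
    ... | tri< j<i _ _ | _ =
      ⊥-elim (<-irrefl (strict-injective s₁ mj mi (trans (ih j<i c mj) t₂j≡t₁i)) j<i)
    ... | _ | tri< k<i _ _ =
      ⊥-elim (<-irrefl (strict-injective s₂ mk mi (trans (sym (ih k<i c mk)) t₁k≡t₂i)) k<i)
    ... | tri> _ _ i<j | tri> _ _ i<k =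
      ⊥-elim (<-asym (subst (t₁ (i , c) <_) t₁k≡t₂i (s₁ mi mk i<k))
                     (subst (t₂ (i , c) <_) t₂j≡t₁i (s₂ mi mj i<j)))

  record ElemStep (t : Placement) (q : Cell) (t′ : Placement) : Set where
    field
      member    : q ∈ D₀
      drop      : t q ≡ suc (t′ q)
      lands     : 1 ≤ t′ q
      free      : (t′ q , col q) ∉ diagramOf t
      rightmost : ∀ c′ → col q < c′ → (t q , c′) ∉ diagramOf t
      unchanged : ∀ {p} → p ∈ D₀ → p ≢ q → t′ p ≡ t p

  module ElemStepProperties {t t′ : Placement} {i c : ℕ} (strict : ColumnStrict t)
                            (st : ElemStep t (i , c) t′) where
    open ElemStep st

    t′<t : t′ (i , c) < t (i , c)
    t′<t = ≤-reflexive (sym drop)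

    MovedFrom : Cell → Set
    MovedFrom x = ((x ∈ diagramOf t) × (x ≢ (t (i , c) , c))) ⊎ (x ≡ (t′ (i , c) , c))

    diagramOf-elemStep : ∀ x → (x ∈ diagramOf t′) ⇔ MovedFrom x
    diagramOf-elemStep (u , c₂) = mk⇔ to from
      where
      same-place : ∀ {j} → (j , c₂) ∈ D₀ → t (j , c₂) ≡ t (i , c) → c₂ ≡ c → (j , c₂) ≡ (i , c)
      same-place mj e refl = cong (_, c) (strict-injective strict mj member e)
      to : (u , c₂) ∈ diagramOf t′ → MovedFrom (u , c₂)
      to m with ∈-diagramOf⁻ t′ m
      ... | j , mj , e with (j , c₂) ≟ᶜ (i , c)
      ...   | yes refl = inj₂ (cong (_, c) (sym e))
      ...   | no j≢i =
        inj₁ (∈-diagramOf⁺ t mj t≡u , λ eq → j≢i (same-place mj (trans t≡u (cong row eq)) (cong col eq)))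
        where
        t≡u : t (j , c₂) ≡ u
        t≡u = trans (sym (unchanged mj j≢i)) e
      from : MovedFrom (u , c₂) → (u , c₂) ∈ diagramOf t′
      from (inj₂ refl) = ∈-diagramOf⁺ t′ member refl
      from (inj₁ (m , x≢)) with ∈-diagramOf⁻ t m
      ... | j , mj , e with (j , c₂) ≟ᶜ (i , c)
      ...   | yes refl = ⊥-elim (x≢ (cong (_, c) (sym e)))
      ...   | no j≢i = ∈-diagramOf⁺ t′ mj (trans (unchanged mj j≢i) e)

    kmove : KMove (diagramOf t) (t (i , c)) c (t′ (i , c)) (diagramOf t′)
    kmove = ∈-diagramOf⁺ t member refl , rightmost , lands , t′<t , free ,
            (λ u lo hi → ⊥-elim (<⇒≱ lo (≤-pred (subst (u <_) drop hi)))) , diagramOf-elemStep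

    elemMove : ElemMove (diagramOf t) (t (i , c) , c) (diagramOf t′)
    elemMove = t′ (i , c) , sym drop , kmove

    strict′ : ColumnStrict t′
    strict′ {j} {k} {c₁} mj mk j<k with (j , c₁) ≟ᶜ (i , c) | (k , c₁) ≟ᶜ (i , c)
    ... | yes refl | yes refl = ⊥-elim (<-irrefl refl j<k)
    ... | yes refl | no k≢i =
      subst (t′ (i , c) <_) (sym (unchanged mk k≢i)) (<-trans t′<t (strict mj mk j<k))
    ... | no j≢i | yes refl =
      subst (_< t′ (i , c)) (sym (unchanged mj j≢i))
            (≤∧≢⇒< (≤-pred (subst (t (j , c) <_) drop (strict mj mk j<k))) (λ e → free (∈-diagramOf⁺ t mj e)))
    ... | no j≢i | no k≢i =
      subst₂ _<_ (sym (unchanged mj j≢i)) (sym (unchanged mk k≢i)) (strict mj mk j<k)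

    positive′ : Positive t → Positive t′
    positive′ pos {p} m with p ≟ᶜ (i , c)
    ... | yes refl = lands
    ... | no p≢i = subst (1 ≤_) (sym (unchanged m p≢i)) (pos m)

    no-placement-between : ∀ {u} → t′ <ᴾ u → u <ᴾ t → ⊥
    no-placement-between (t′≤u , p , mp , t′p<up) (u≤t , q , mq , uq<tq) with q ≟ᶜ (i , c)
    ... | no q≢i = <⇒≱ uq<tq (subst (_≤ _) (unchanged mq q≢i) (t′≤u mq))
    ... | yes refl with p ≟ᶜ (i , c)
    ...   | yes refl = <⇒≱ t′p<up (≤-pred (subst (_ <_) drop uq<tq))
    ...   | no p≢i = <⇒≱ t′p<up (subst (_ ≤_) (sym (unchanged mp p≢i)) (u≤t mp))

    covered : CoveredBy D₀ (diagramOf t′) (diagramOf t)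
    covered = [ _ , _ , _ , kmove ] , nothing-between
      where
      nothing-between : ¬ Σ Diagram λ F → InP D₀ F × (diagramOf t′ ≺ F) × (F ≺ diagramOf t)
      nothing-between (F , _ , t′≺F , F≺t) with descent-placement strict ≐-refl F≺t
      ... | u , strict-u , F≐ , u<t with descent-placement strict-u F≐ t′≺F
      ...   | w , strict-w , t′≐ , w<u =
        no-placement-between (<ᴾ-respˡ-≈ (diagramOf-injective strict-w strict′ (≐-sym t′≐)) w<u) u<t

  record Reached (t : Placement) : Set where
    field
      strict    : ColumnStrict t
      positive  : Positive t
      reachable : InP D₀ (diagramOf t)

  reached-step : ∀ {t t′ i c} → ElemStep t (i , c) t′ → Reached t → Reached t′
  reached-step st reached = record
    { strict = strict′ ; positive = positive′ positive ; reachable = InP-step reachable (_ , _ , _ , kmove) }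
    where
    open Reached reached
    open ElemStepProperties strict st

  reached-row : PositiveDiagram D₀ → Reached row
  reached-row pos = record
    { strict = λ _ _ i<j → i<j
    ; positive = Invariant.positive (invariant-row pos)
    ; reachable = D₀ , ε , diagramOf-row
    }

  ElemStep-respˡ : ∀ {t₁ t₂ q t′} → t₁ ≈ t₂ → ElemStep t₂ q t′ → ElemStep t₁ q t′
  ElemStep-respˡ {q = q} {t′} e st = record
    { member = member
    ; drop = trans (e member) drop
    ; lands = lands
    ; free = subst (λ D → (t′ q , col q) ∉ D) (sym (diagramOf-cong e)) free
    ; rightmost = λ c′ lt →
        subst₂ (λ u D → (u , c′) ∉ D) (sym (e member)) (sym (diagramOf-cong e)) (rightmost c′ lt)
    ; unchanged = λ m p≢q → trans (unchanged m p≢q) (sym (e m))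
    }
    where open ElemStep st

  -- The move label of an elementary step of the cell (i , c) of D₀ is i (labelAt-correct),
  -- so the move labels along a run are weakly increasing and at least lo.
  data Run (lo : ℕ) : Placement → Placement → Set where
    done : ∀ {t t′} → t ≈ t′ → Run lo t t′
    step : ∀ {t t′ t″ i c} → ElemStep t (i , c) t′ → lo ≤ i → Run i t′ t″ → Run lo t t″

  Run-resp : ∀ {lo t₁ t₂ t} → t₁ ≈ t₂ → Run lo t₂ t → Run lo t₁ t
  Run-resp e (done e′) = done (≈-trans e e′)
  Run-resp e (step st le run) = step (ElemStep-respˡ e st) le run

  Run-weaken : ∀ {lo lo′ t t′} → lo ≤ lo′ → Run lo′ t t′ → Run lo t t′
  Run-weaken _ (done e) = done e
  Run-weaken lo≤lo′ (step st le run) = step st (≤-trans lo≤lo′ le) run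

  length : ∀ {lo t t′} → Run lo t t′ → ℕ
  length (done _) = 0
  length (step _ _ run) = suc (length run)

  placementAt : ∀ {lo t t′} → Run lo t t′ → ℕ → Placement
  placementAt {t = t} _ zero = t
  placementAt {t = t} (done _) (suc _) = t
  placementAt (step _ _ run) (suc a) = placementAt run a

  movedAt : ∀ {lo t t′} → Run lo t t′ → ℕ → Cell
  movedAt (done _) _ = 0 , 0
  movedAt (step {i = i} {c} _ _ _) zero = i , c
  movedAt (step _ _ run) (suc a) = movedAt run a

  stepAt : ∀ {lo t t′} (run : Run lo t t′) {a} → a < length run →
    ElemStep (placementAt run a) (movedAt run a) (placementAt run (suc a))
  stepAt (step st _ _) {zero} _ = st
  stepAt (step _ _ run) {suc a} (s≤s a<len) = stepAt run a<len

  reached-at : ∀ {lo t t′} (run : Run lo t t′) → Reached t → ∀ a → Reached (placementAt run a)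
  reached-at _ reached zero = reached
  reached-at (done _) reached (suc _) = reached
  reached-at (step st _ run) reached (suc a) = reached-at run (reached-step st reached) a

  placementAt-length : ∀ {lo t t′} (run : Run lo t t′) → placementAt run (length run) ≈ t′
  placementAt-length (done e) = e
  placementAt-length (step _ _ run) = placementAt-length run

  lo≤movedAt : ∀ {lo t t′} (run : Run lo t t′) {a} → a < length run → lo ≤ row (movedAt run a)
  lo≤movedAt (step _ le _) {zero} _ = le
  lo≤movedAt (step _ le run) {suc a} (s≤s a<len) = ≤-trans le (lo≤movedAt run a<len)

  movedAt-mono : ∀ {lo t t′} (run : Run lo t t′) {a b} → a < b → b < length run →
    row (movedAt run a) ≤ row (movedAt run b)
  movedAt-mono (step _ _ run) {zero} {suc b} _ (s≤s b<len) = lo≤movedAt run b<len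
  movedAt-mono (step _ _ run) {suc a} {suc b} (s≤s a<b) (s≤s b<len) = movedAt-mono run a<b b<len

  Run-chain : PositiveDiagram D₀ → ∀ {lo t t′} → Run lo t t′ → Reached t →
    Σ (ElementaryChain D₀) λ ch →
      (Ds ch 0 ≡ diagramOf t) × (Ds ch (M ch) ≡ diagramOf t′) × NoMoveInversions ch
  Run-chain pos run reached = chain , refl , diagramOf-cong (placementAt-length run) , sorted
    where
    strictAt : ∀ a → ColumnStrict (placementAt run a)
    strictAt a = Reached.strict (reached-at run reached a)
    chain : ElementaryChain D₀
    chain = record
      { M = length run
      ; Ds = λ a → diagramOf (placementAt run a)
      ; cells = λ a → placementAt run a (movedAt run a) , col (movedAt run a)
      ; labs = λ a → row (movedAt run a)
      ; inP = λ a _ → Reached.reachable (reached-at run reached a)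
      ; elem = λ a a<M → ElemStepProperties.elemMove (strictAt a) (stepAt run a<M)
      ; cover = λ a a<M → ElemStepProperties.covered (strictAt a) (stepAt run a<M)
      ; label = λ a a<M → labelAt (placementAt run a) , standardLabeling pos (strictAt a) ,
                          labelAt-correct (strictAt a) (ElemStep.member (stepAt run a<M))
      }
    sorted : NoMoveInversions chain
    sorted a b a<b b<M = ≤⇒≯ (movedAt-mono run a<b b<M)

  module Greedy (T : Placement) (inv : Invariant T) where
    open Invariant inv

    -- The cells before q are at their rows in T, q is at row u, the cells after q are untouched.
    state : Cell → ℕ → Placement
    state q u p with p ⊏? q | p ≟ᶜ q
    ... | yes _ | _ = T p
    ... | no _ | yes _ = u
    ... | no _ | no _ = row p

    state-processed : ∀ {p q u} → p ⊏ q → state q u p ≡ T p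
    state-processed {p} {q} p⊏q with p ⊏? q
    ... | yes _ = refl
    ... | no p⋢q = ⊥-elim (p⋢q p⊏q)

    state-current : ∀ q {u} → state q u q ≡ u
    state-current q with q ⊏? q | q ≟ᶜ q
    ... | yes q⊏q | _ = ⊥-elim (⊏-irrefl q⊏q)
    ... | no _ | yes _ = refl
    ... | no _ | no q≢q = ⊥-elim (q≢q refl)

    state-pending : ∀ {p q u} → ¬ p ⊏ q → p ≢ q → state q u p ≡ row p
    state-pending {p} {q} p⋢q p≢q with p ⊏? q | p ≟ᶜ q
    ... | yes p⊏q | _ = ⊥-elim (p⋢q p⊏q)
    ... | no _ | yes p≡q = ⊥-elim (p≢q p≡q)
    ... | no _ | no _ = refl

    state-elsewhere : ∀ {p q u u′} → p ≢ q → state q u p ≡ state q u′ p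
    state-elsewhere {p} {q} p≢q with p ⊏? q | p ≟ᶜ q
    ... | yes _ | _ = refl
    ... | no _ | yes p≡q = ⊥-elim (p≢q p≡q)
    ... | no _ | no _ = refl

    state-unprocessed : ∀ {p q} → ¬ p ⊏ q → state q (row q) p ≡ row p
    state-unprocessed {p} {q} p⋢q = by-cases (p ≟ᶜ q)
      where
      by-cases : Dec (p ≡ q) → state q (row q) p ≡ row p
      by-cases (yes p≡q) = subst (λ x → state q (row q) x ≡ row x) (sym p≡q) (state-current q)
      by-cases (no p≢q) = state-pending p⋢q p≢q

    state-above : ∀ {i j c c′ u} → i < j → state (i , c) u (j , c′) ≡ j
    state-above i<j =
      state-pending [ (λ j<i → <-asym j<i i<j) , (λ (j≡i , _) → <-irrefl (sym j≡i) i<j) ]′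
                    (λ eq → <-irrefl (sym (cong row eq)) i<j)

    advance : ∀ q q′ → (∀ {p} → p ∈ D₀ → p ⊏ q′ ⇔ (p ⊏ q ⊎ p ≡ q)) →
      state q (T q) ≈ state q′ (row q′)
    advance q q′ order {p} m = by-cases (p ⊏? q) (p ≟ᶜ q)
      where
      settled : p ⊏ q ⊎ p ≡ q → state q′ (row q′) p ≡ T p
      settled before = state-processed (Equivalence.from (order m) before)
      by-cases : Dec (p ⊏ q) → Dec (p ≡ q) → state q (T q) p ≡ state q′ (row q′) p
      by-cases (yes p⊏q) _ = trans (state-processed p⊏q) (sym (settled (inj₁ p⊏q)))
      by-cases (no _) (yes p≡q) =
        trans (subst (λ x → state q (T q) x ≡ T x) (sym p≡q) (state-current q))
              (sym (settled (inj₂ p≡q)))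
      by-cases (no p⋢q) (no p≢q) =
        trans (state-pending p⋢q p≢q)
              (sym (state-unprocessed λ p⊏q′ → [ p⋢q , p≢q ]′ (Equivalence.to (order m) p⊏q′)))

    settle-step : ∀ {i c d} → (i , c) ∈ D₀ → T (i , c) + suc d ≤ i →
      ElemStep (state (i , c) (T (i , c) + suc d)) (i , c) (state (i , c) (T (i , c) + d))
    settle-step {i} {c} {d} m fits = record
      { member = m
      ; drop = trans (state-current (i , c)) (trans (+-suc _ d) (cong suc (sym (state-current (i , c)))))
      ; lands = subst (1 ≤_) (sym (state-current (i , c))) (≤-trans (positive m) (m≤m+n _ d))
      ; free = subst (λ u → (u , c) ∉ diagramOf t) (sym (state-current (i , c))) free
      ; rightmost = λ c′ c<c′ →
          subst (λ u → (u , c′) ∉ diagramOf t) (sym (state-current (i , c))) (rightmost c′ c<c′)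
      ; unchanged = λ _ p≢q → state-elsewhere p≢q
      }
      where
      t : Placement
      t = state (i , c) (T (i , c) + suc d)
      below-top : T (i , c) + d < T (i , c) + suc d
      below-top = +-monoʳ-< (T (i , c)) (n<1+n d)
      free : (T (i , c) + d , c) ∉ diagramOf t
      free m′ with ∈-diagramOf⁻ t m′
      ... | j , mj , e with <-cmp j i
      ...   | tri< j<i _ _ =
        <⇒≱ (strict mj m j<i) (subst (T (i , c) ≤_) (trans (sym e) (state-processed (inj₁ j<i))) (m≤m+n _ d))
      ...   | tri≈ _ refl _ = <-irrefl (trans (sym e) (state-current (i , c))) below-top
      ...   | tri> _ _ i<j = <-irrefl (trans (sym e) (state-above i<j)) (<-trans (<-≤-trans below-top fits) i<j)
      too-high : ∀ {j c′} → c < c′ → (j , c′) ∈ D₀ → j ≤ i → T (j , c′) ≡ T (i , c) + suc d → ⊥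
      too-high c<c′ mj j≤i eq =
        <⇒≱ (m<m+n (T (i , c)) z<s) (subst (_≤ T (i , c)) eq (dominated m mj c<c′ j≤i))
      rightmost : ∀ c′ → c < c′ → (T (i , c) + suc d , c′) ∉ diagramOf t
      rightmost c′ c<c′ m′ with ∈-diagramOf⁻ t m′
      ... | j , mj , e with <-cmp j i
      ...   | tri< j<i _ _ = too-high c<c′ mj (<⇒≤ j<i) (trans (sym (state-processed (inj₁ j<i))) e)
      ...   | tri≈ _ refl _ = too-high c<c′ mj ≤-refl (trans (sym (state-processed (inj₂ (refl , c<c′)))) e)
      ...   | tri> _ _ i<j = <-irrefl (trans (sym e) (state-above i<j)) (≤-<-trans fits i<j)

    settle : ∀ {i c t} → Run i (state (i , c) (T (i , c))) t → Run i (state (i , c) i) t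
    settle {i} {c} {t} rest with any? ((i , c) ≟ᶜ_) D₀
    ... | no ∉D₀ = Run-resp (λ m → state-elsewhere λ p≡q → ∉D₀ (subst (_∈ D₀) p≡q m)) rest
    ... | yes m = subst (λ u → Run i (state (i , c) u) t) (m+[n∸m]≡n (descended m))
                        (descend (i ∸ T (i , c)) (≤-reflexive (m+[n∸m]≡n (descended m))))
      where
      descend : ∀ d → T (i , c) + d ≤ i → Run i (state (i , c) (T (i , c) + d)) t
      descend zero _ = subst (λ u → Run i (state (i , c) u) t) (sym (+-identityʳ _)) rest
      descend (suc d) fits =
        step (settle-step m fits) ≤-refl (descend d (≤-trans (+-monoʳ-≤ _ (n≤1+n d)) fits))

    maxRow maxCol : ℕ
    maxRow = max 0 (map row D₀)
    maxCol = max 0 (map col D₀)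

    row-run : ∀ {i} → Run (suc i) (state (suc i , maxCol) (suc i)) T → ∀ c → Run i (state (i , c) i) T
    row-run {i} rest zero =
      settle (Run-resp (advance (i , 0) (suc i , maxCol) λ {p} m → ⊏-upward p (≤-max col m))
                       (Run-weaken (n≤1+n _) rest))
    row-run {i} rest (suc c) =
      settle (Run-resp (advance (i , suc c) (i , c) λ {p} _ → ⊏-leftward p) (row-run rest c))

    rows-run : ∀ d {i} → d + i ≡ suc maxRow → Run i (state (i , maxCol) i) T
    rows-run zero refl = done λ m → state-processed (inj₁ (s≤s (≤-max row m)))
    rows-run (suc d) {i} e = row-run (rows-run d (trans (+-suc d i) e)) maxCol

    greedy-run : Run 0 row T
    greedy-run =
      Run-resp (λ m → sym (state-unprocessed (nothing-before m))) (rows-run (suc maxRow) (+-identityʳ _))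
      where
      nothing-before : ∀ {p} → p ∈ D₀ → ¬ p ⊏ (0 , maxCol)
      nothing-before m (inj₂ (_ , maxCol<c)) = <⇒≱ maxCol<c (≤-max col m)

proposition2p21 : (D₀ D : Diagram) → PositiveDiagram D₀ → Northeast D₀ → InP D₀ D →
    Σ (ElementaryChain D₀) λ ch → (Ds ch 0 ≐ D₀) × (Ds ch (M ch) ≐ D) × NoMoveInversions ch
proposition2p21 D₀ D pos ne (E , D₀↝E , E≐D) =
  let open Placements D₀
      (T , inv , E≐T) = reachable-placement ne D₀↝E (invariant-row pos) diagramOf-row
      (chain , first , last , sorted) = Run-chain pos (Greedy.greedy-run T inv) (reached-row pos)
  in chain , ≐-trans (≐-reflexive first) (≐-sym diagramOf-row) ,
     ≐-trans (≐-reflexive last) (≐-trans (≐-sym E≐T) E≐D) , sorted
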